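{- For all integers $w$ and $r\ge0$, \[ \sum_{p=0}^r(-1)^{r-p}(w+2p-2r)\binom{w}{r-p}\binom{w+p-2r-1}{p}=\begin{cases}w&\text{if } r=0,\\ 0&\text{if } r\ge1.\end{cases} \]
   Context: For a nonnegative integer $k$ and any number $z$, $\binom{z}{k}=\frac{\prod_{a=0}^{k-1}(z-a)}{k!}$ (so binomial coefficients with negative upper entry are defined by this polynomial formula). -}

module Defs where

open import Data.Nat using (ℕ; zero; suc; _!; _∸_)
open import Data.Nat.Properties using (_!≢0)
open import Data.Integer using (ℤ; +_; _-_; _*_; _+_; -_)
open import Data.Integer.DivMod using (_/ℕ_)

fallingFactorial : ℤ → ℕ → ℤ
fallingFactorial z zero    = + 1
fallingFactorial z (suc k) = fallingFactorial z k * (z - + k)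

-- generalized binomial coefficient  binom z k = (∏_{a<k} (z - a)) / k!
-- (the division is exact; integer division is used)
binom : ℤ → ℕ → ℤ
binom z k = fallingFactorial z k /ℕ (k !)
  where instance _ = k !≢0

signℤ : ℕ → ℤ
signℤ zero    = + 1
signℤ (suc n) = - signℤ n

sumTo : ℕ → (ℕ → ℤ) → ℤ
sumTo zero    f = f zero
sumTo (suc r) f = sumTo r f + f (suc r)

lhs5p2 : ℤ → ℕ → ℤ
lhs5p2 w r = sumTo r (λ p → signℤ (r ∸ p) * (w + + 2 * + p - + 2 * + r)
                            * binom w (r ∸ p) * binom (w + + p - + 2 * + r - + 1) p)

{-# OPTIONS --safe #-}
-- Writing t_r(q) for the q-th summand of the r-th sum, the partial sums satisfy,
-- for p + j = r,
--   r · Σ_{q ≤ p} t_r(q) = (-1)^j · j · (p+1) · C(w, j) · C(w+p-2r, p+1),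
-- by induction on p with r fixed, using only the absorption identities
-- (k+1) C(z, k+1) = (z-k) C(z, k) and (k+1) C(z+1, k+1) = (z+1) C(z, k).
-- At p = r we have j = 0, so r times the whole sum vanishes.
-- Both identities need the integer division defining C(z, k) to be exact:
-- k! divides z(z-1)⋯(z-k+1) by induction on z ∈ ℤ in both directions, via Pascal's rule.
module Submission where

open import Defs
open import Data.Nat using (ℕ; zero; suc; _!)
open import Data.Integer using (ℤ; +_)
open import Data.Product using (_×_)
open import Relation.Binary.PropositionalEquality using (_≡_)

import Data.Nat as ℕ
import Data.Nat.Properties as ℕ
import Data.Nat.DivMod as ℕ
open import Data.Nat.Properties using (_!≢0)
open import Data.Integer using (-[1+_]; _*_; _+_; _-_; -_; _/ℕ_; 0ℤ; 1ℤ)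
open import Data.Integer.Properties
  using (pos-*; *-comm; *-assoc; *-identityˡ; *-zeroʳ; *-cancelʳ-≡; *-cancelˡ-≡; *-distribˡ-+)
open import Data.Integer.Divisibility.Signed
  using (_∣_; divides; ∣m∣n⇒∣m+n; ∣m+n∣n⇒∣m; *-monoʳ-∣)
open import Data.Integer.Tactic.RingSolver using (solve-∀; solve)
open import Data.List using ([]; _∷_)
open import Data.Product using (_,_)
open import Relation.Binary.PropositionalEquality
  using (refl; sym; trans; cong; cong₂; subst; module ≡-Reasoning)
open ≡-Reasoning

ℤ-induction : ∀ {ℓ} (P : ℤ → Set ℓ) → P 0ℤ →
              (∀ z → P z → P (z + 1ℤ)) → (∀ z → P (z + 1ℤ) → P z) → ∀ z → P z
ℤ-induction P P0 up down (+ zero)     = P0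
ℤ-induction P P0 up down (+ suc n)    =
  subst P (cong +_ (ℕ.+-comm n 1)) (up (+ n) (ℤ-induction P P0 up down (+ n)))
ℤ-induction P P0 up down -[1+ zero ]  = down -[1+ zero ] P0
ℤ-induction P P0 up down -[1+ suc n ] = down -[1+ suc n ] (ℤ-induction P P0 up down -[1+ n ])

[i*n]/ℕn≡i : ∀ i n .{{_ : ℕ.NonZero n}} → (i * + n) /ℕ n ≡ i
[i*n]/ℕn≡i (+ zero)  n@(suc _) = refl
[i*n]/ℕn≡i (+ suc m) n@(suc _) = cong +_ (ℕ.m*n/n≡m (suc m) n)
[i*n]/ℕn≡i -[1+ m ]  n@(suc _) with suc m ℕ.* n ℕ.% n | ℕ.m*n%n≡0 (suc m) n
... | .zero | refl = cong (λ k → - (+ k)) (ℕ.m*n/n≡m (suc m) n)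

fallingFactorial-zero : ∀ k → fallingFactorial 0ℤ (suc k) ≡ 0ℤ
fallingFactorial-zero zero    = refl
fallingFactorial-zero (suc k) = cong (_* (0ℤ - + suc k)) (fallingFactorial-zero k)

fallingFactorial-shift : ∀ z k →
  fallingFactorial (z + 1ℤ) (suc k) ≡ (z + 1ℤ) * fallingFactorial z k
fallingFactorial-shift z zero    = begin
  + 1 * (z + 1ℤ - + 0) ≡⟨ solve (z ∷ []) ⟩
  (z + 1ℤ) * + 1       ∎
fallingFactorial-shift z (suc k) = begin
  fallingFactorial (z + 1ℤ) (suc k) * (z + 1ℤ - (+ 1 + + k))
    ≡⟨ cong (_* (z + 1ℤ - (+ 1 + + k))) (fallingFactorial-shift z k) ⟩
  (z + 1ℤ) * fallingFactorial z k * (z + 1ℤ - (+ 1 + + k))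
    ≡⟨ reassociate z (fallingFactorial z k) (+ k) ⟩
  (z + 1ℤ) * (fallingFactorial z k * (z - + k)) ∎
  where
  reassociate : ∀ z f k → (z + 1ℤ) * f * (z + 1ℤ - (+ 1 + k)) ≡ (z + 1ℤ) * (f * (z - k))
  reassociate = solve-∀

fallingFactorial-pascal : ∀ z k → fallingFactorial (z + 1ℤ) (suc k) ≡
  fallingFactorial z (suc k) + + suc k * fallingFactorial z k
fallingFactorial-pascal z k = trans (fallingFactorial-shift z k) (split z (fallingFactorial z k) (+ k))
  where
  split : ∀ z f k → (z + 1ℤ) * f ≡ f * (z - k) + (+ 1 + k) * f
  split = solve-∀

k!∣fallingFactorial : ∀ z k → + (k !) ∣ fallingFactorial z k
k!∣fallingFactorial z zero    = divides (+ 1) refl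
k!∣fallingFactorial z (suc k) =
  ℤ-induction (λ z → + (suc k !) ∣ fallingFactorial z (suc k))
    (divides 0ℤ (fallingFactorial-zero k)) up down z
  where
  [1+k]!∣[1+k]*ff : ∀ z → + (suc k !) ∣ + suc k * fallingFactorial z k
  [1+k]!∣[1+k]*ff z = subst (_∣ + suc k * fallingFactorial z k) (sym (pos-* (suc k) (k !)))
                            (*-monoʳ-∣ (+ suc k) (k!∣fallingFactorial z k))
  up : ∀ z → + (suc k !) ∣ fallingFactorial z (suc k) → + (suc k !) ∣ fallingFactorial (z + 1ℤ) (suc k)
  up z ∣ff = subst (_ ∣_) (sym (fallingFactorial-pascal z k)) (∣m∣n⇒∣m+n ∣ff ([1+k]!∣[1+k]*ff z))
  down : ∀ z → + (suc k !) ∣ fallingFactorial (z + 1ℤ) (suc k) → + (suc k !) ∣ fallingFactorial z (suc k)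
  down z ∣ff = ∣m+n∣n⇒∣m (subst (_ ∣_) (fallingFactorial-pascal z k) ∣ff) ([1+k]!∣[1+k]*ff z)

binom*k!≡fallingFactorial : ∀ z k → binom z k * + (k !) ≡ fallingFactorial z k
binom*k!≡fallingFactorial z k with k!∣fallingFactorial z k
... | divides q ff≡q*k! = begin
  (fallingFactorial z k /ℕ k !) * + (k !) ≡⟨ cong (λ x → (x /ℕ k !) * + (k !)) ff≡q*k! ⟩
  (q * + (k !) /ℕ k !) * + (k !)          ≡⟨ cong (_* + (k !)) ([i*n]/ℕn≡i q (k !)) ⟩
  q * + (k !)                              ≡⟨ sym ff≡q*k! ⟩
  fallingFactorial z k                     ∎
  where instance _ = k !≢0

[1+k]*binom[z,1+k]*k!≡fallingFactorial : ∀ z k →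
  + suc k * binom z (suc k) * + (k !) ≡ fallingFactorial z (suc k)
[1+k]*binom[z,1+k]*k!≡fallingFactorial z k = begin
  + suc k * binom z (suc k) * + (k !)   ≡⟨ cong (_* + (k !)) (*-comm (+ suc k) (binom z (suc k))) ⟩
  binom z (suc k) * + suc k * + (k !)   ≡⟨ *-assoc (binom z (suc k)) (+ suc k) (+ (k !)) ⟩
  binom z (suc k) * (+ suc k * + (k !)) ≡⟨ cong (binom z (suc k) *_) (sym (pos-* (suc k) (k !))) ⟩
  binom z (suc k) * + (suc k !)         ≡⟨ binom*k!≡fallingFactorial z (suc k) ⟩
  fallingFactorial z (suc k)            ∎

binom-absorption : ∀ z k → + suc k * binom z (suc k) ≡ (z - + k) * binom z k
binom-absorption z k = *-cancelʳ-≡ _ _ (+ (k !)) {{k !≢0}} (begin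
  + suc k * binom z (suc k) * + (k !) ≡⟨ [1+k]*binom[z,1+k]*k!≡fallingFactorial z k ⟩
  fallingFactorial z k * (z - + k)    ≡⟨ cong (_* (z - + k)) (sym (binom*k!≡fallingFactorial z k)) ⟩
  binom z k * + (k !) * (z - + k)     ≡⟨ *-comm (binom z k * + (k !)) (z - + k) ⟩
  (z - + k) * (binom z k * + (k !))   ≡⟨ sym (*-assoc (z - + k) (binom z k) (+ (k !))) ⟩
  (z - + k) * binom z k * + (k !)     ∎)

binom-absorption-shift : ∀ z k → + suc k * binom (z + 1ℤ) (suc k) ≡ (z + 1ℤ) * binom z k
binom-absorption-shift z k = *-cancelʳ-≡ _ _ (+ (k !)) {{k !≢0}} (begin
  + suc k * binom (z + 1ℤ) (suc k) * + (k !) ≡⟨ [1+k]*binom[z,1+k]*k!≡fallingFactorial (z + 1ℤ) k ⟩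
  fallingFactorial (z + 1ℤ) (suc k)          ≡⟨ fallingFactorial-shift z k ⟩
  (z + 1ℤ) * fallingFactorial z k            ≡⟨ cong ((z + 1ℤ) *_) (sym (binom*k!≡fallingFactorial z k)) ⟩
  (z + 1ℤ) * (binom z k * + (k !))           ≡⟨ sym (*-assoc (z + 1ℤ) (binom z k) (+ (k !))) ⟩
  (z + 1ℤ) * binom z k * + (k !)             ∎)

binom-one : ∀ z → binom z 1 ≡ z
binom-one z = begin
  binom z 1           ≡⟨ sym (*-identityˡ (binom z 1)) ⟩
  + 1 * binom z 1     ≡⟨ binom-absorption z 0 ⟩
  (z - + 0) * + 1     ≡⟨ solve (z ∷ []) ⟩
  z                   ∎

summand : ℤ → ℕ → ℕ → ℤ
summand w r p = signℤ (r ℕ.∸ p) * (w + + 2 * + p - + 2 * + r)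
                * binom w (r ℕ.∸ p) * binom (w + + p - + 2 * + r - + 1) p

partialSum-closedForm : ∀ w p j r → p ℕ.+ j ≡ r →
  + r * sumTo p (summand w r) ≡
  signℤ j * + j * + suc p * binom w j * binom (w + + p - + 2 * + r) (suc p)
partialSum-closedForm w zero    j .j refl = begin
  J * (s * (w + + 2 * + 0 - + 2 * J) * A * + 1) ≡⟨ regroup J s w A ⟩
  s * J * + 1 * A * (w + + 0 - + 2 * J)         ≡⟨ cong (s * J * + 1 * A *_) (sym (binom-one _)) ⟩
  s * J * + 1 * A * binom (w + + 0 - + 2 * J) 1 ∎
  where
  J = + j
  s = signℤ j
  A = binom w j
  regroup : ∀ J s w A → J * (s * (w + + 2 * + 0 - + 2 * J) * A * + 1) ≡ s * J * + 1 * A * (w + + 0 - + 2 * J)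
  regroup = solve-∀
partialSum-closedForm w (suc p) j .(suc p ℕ.+ j) refl = begin
  R * (sumTo p (summand w r) + summand w r (suc p))
    ≡⟨ *-distribˡ-+ R (sumTo p (summand w r)) (summand w r (suc p)) ⟩
  R * sumTo p (summand w r) + R * summand w r (suc p)
    ≡⟨ cong₂ _+_ (partialSum-closedForm w p (suc j) r (ℕ.+-suc p j)) (cong (R *_) last-summand) ⟩
  (- s) * (+ 1 + J) * (+ 1 + P) * A′ * B + R * (s * c * A * B)
    ≡⟨ regroup s J P A′ B (R * (s * c * A * B)) ⟩
  (- s) * (+ 1 + P) * B * ((+ 1 + J) * A′) + R * (s * c * A * B)
    ≡⟨ cong (λ x → (- s) * (+ 1 + P) * B * x + R * (s * c * A * B)) (binom-absorption w j) ⟩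
  (- s) * (+ 1 + P) * B * ((w - J) * A) + R * (s * c * A * B)
    ≡⟨ coefficient s w J P A B ⟩
  s * J * A * ((z + 1ℤ) * B)
    ≡⟨ cong (s * J * A *_) (sym (binom-absorption-shift z (suc p))) ⟩
  s * J * A * ((+ 1 + (+ 1 + P)) * B″)
    ≡⟨ regroup′ s J P A B″ ⟩
  s * J * (+ 1 + (+ 1 + P)) * A * B″
    ≡⟨ cong (λ x → s * J * (+ 1 + (+ 1 + P)) * A * binom x (suc (suc p))) (sym (shifted-argument w P R)) ⟩
  s * J * (+ 1 + (+ 1 + P)) * A * binom (w + (+ 1 + P) - + 2 * R) (suc (suc p)) ∎
  where
  r = suc p ℕ.+ j
  R = + r
  J = + j
  P = + p
  s = signℤ j
  A = binom w j
  A′ = binom w (suc j)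
  c = w + + 2 * (+ 1 + P) - + 2 * R
  z = w + P - + 2 * R
  B = binom z (suc p)
  B″ = binom (z + 1ℤ) (suc (suc p))
  lowered-argument : ∀ w P R → w + (+ 1 + P) - + 2 * R - + 1 ≡ w + P - + 2 * R
  lowered-argument = solve-∀
  shifted-argument : ∀ w P R → w + (+ 1 + P) - + 2 * R ≡ w + P - + 2 * R + + 1
  shifted-argument = solve-∀
  last-summand : summand w r (suc p) ≡ s * c * A * B
  last-summand rewrite ℕ.m+n∸m≡n (suc p) j =
    cong (λ x → s * c * A * binom x (suc p)) (lowered-argument w P R)
  regroup : ∀ s J P A′ B X → (- s) * (+ 1 + J) * (+ 1 + P) * A′ * B + X ≡ (- s) * (+ 1 + P) * B * ((+ 1 + J) * A′) + X
  regroup = solve-∀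
  coefficient : ∀ s w J P A B →
    (- s) * (+ 1 + P) * B * ((w - J) * A) + (+ 1 + P + J) * (s * (w + + 2 * (+ 1 + P) - + 2 * (+ 1 + P + J)) * A * B)
    ≡ s * J * A * ((w + P - + 2 * (+ 1 + P + J) + 1ℤ) * B)
  coefficient = solve-∀
  regroup′ : ∀ s J P A B″ → s * J * A * ((+ 1 + (+ 1 + P)) * B″) ≡ s * J * (+ 1 + (+ 1 + P)) * A * B″
  regroup′ = solve-∀

lemma5p2 : (w : ℤ) →
    (lhs5p2 w zero ≡ w) × ((r : ℕ) → lhs5p2 w (suc r) ≡ + 0)
lemma5p2 w = lhs5p2-zero , lhs5p2-suc
  where
  lhs5p2-zero : lhs5p2 w zero ≡ w
  lhs5p2-zero = begin
    lhs5p2 w zero                                 ≡⟨⟩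
    + 1 * (w + + 2 * + 0 - + 2 * + 0) * + 1 * + 1 ≡⟨ solve (w ∷ []) ⟩
    w                                             ∎
  lhs5p2-suc : ∀ r → lhs5p2 w (suc r) ≡ + 0
  lhs5p2-suc r = *-cancelˡ-≡ (+ suc r) _ _ (begin
    + suc r * lhs5p2 w (suc r) ≡⟨ partialSum-closedForm w (suc r) 0 (suc r) (ℕ.+-identityʳ (suc r)) ⟩
    + 0                        ≡⟨ sym (*-zeroʳ (+ suc r)) ⟩
    + suc r * + 0              ∎)
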